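{- Let $\lambda=(1^{a_1},2^{a_2})$ with $a_1,a_2\ge1$, $n=a_1+a_2$, so the terminal vertices of $\Gamma_\lambda$ are $(0,n)$, $t_1=(a_1,a_2)$, $(n,0)$. Every ladder diagram $L$ contains the edges $M$ of the segment from $(0,0)$ to $(0,n)$ and of the segment from $(0,0)$ to $(n,0)$; let $P(L)$ be the set of edges of $L$ lying on some North-East path in $L$ from $(0,0)$ to $t_1$. Define $\tau(L)=M\cup r(P(L))$, where $r(x,y)=(a_1-x,a_2-y)$ is the $180^\circ$ rotation of the rectangle $[0,a_1]\times[0,a_2]$. Then $\tau$ is a well-defined automorphism of the poset $\mathcal{F}(\Gamma_\lambda)$ (equivalently of the face poset of $\mathrm{GT}_\lambda$) of order $2$.
   Context: Let $\lambda=(1^{a_1},\ldots,m^{a_m})$ ($a_1$ copies of $1$, then $a_2$ copies of $2$, etc.), $n=\sum a_i$, $s_j=a_1+\cdots+a_j$ ($s_0=0$). Let $Q$ be the graph on $\mathbb{Z}_{\ge0}^2$ with edges $\{(i,j),(i+1,j)\}$, $\{(i,j),(i,j+1)\}$. The origin is $(0,0)$ and the terminal vertices are $t_j=(s_j,n-s_j)$, $0\le j\le m$. The grid $\Gamma_\lambda$ is the subgraph of $Q$ consisting of all vertices and edges lying on some North-East lattice path from the origin to a terminal vertex. A ladder diagram is a subgraph $L\subseteq\Gamma_\lambda$ such that every terminal vertex is joined to the origin by a North-East path in $L$, and every edge of $L$ lies on a North-East path in $L$ from the origin to some terminal vertex. $\mathcal{F}(\Gamma_\lambda)$ is the set of ladder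 diagrams ordered by inclusion; by a known result (An–Cho–Kim) it is isomorphic to the face poset of the Gelfand–Tsetlin polytope $\mathrm{GT}_\lambda$ (points $(x_{i,j})_{1\le j\le i\le n}$ with $x_{i,i}=\lambda_i$ and rows and columns of the triangular array weakly increasing). -}

module Defs where

open import Data.Nat using (ℕ; zero; suc; _+_; _∸_; _<_)
open import Data.Product using (Σ; _×_; _,_; ∃)
open import Data.Sum using (_⊎_)
open import Data.Unit using (⊤)
open import Level using (0ℓ)
open import Relation.Unary using (Pred; _⊆_)
open import Relation.Binary.PropositionalEquality using (_≡_)

Vertex : Set
Vertex = ℕ × ℕ

origin : Vertex
origin = (0 , 0)

-- Edges of Q:  hor x y = {(x,y),(x+1,y)},  ver x y = {(x,y),(x,y+1)}.
data Edge : Set where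
  hor : ℕ → ℕ → Edge
  ver : ℕ → ℕ → Edge

src : Edge → Vertex
src (hor x y) = (x , y)
src (ver x y) = (x , y)

tgt : Edge → Vertex
tgt (hor x y) = (suc x , y)
tgt (ver x y) = (x , suc y)

-- A subgraph of Q, given by its edge set.
Subgraph : Set₁
Subgraph = Pred Edge 0ℓ

Q : Subgraph
Q _ = ⊤

data NEPath (L : Subgraph) : Vertex → Vertex → Set where
  stop  : ∀ {u} → NEPath L u u
  east  : ∀ {x y w} → L (hor x y) → NEPath L (suc x , y) w → NEPath L (x , y) w
  north : ∀ {x y w} → L (ver x y) → NEPath L (x , suc y) w → NEPath L (x , y) w

OnPath : Subgraph → Edge → Vertex → Set
OnPath L e t = L e × NEPath L origin (src e) × NEPath L (tgt e) t

module Shape (a₁ a₂ : ℕ) where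
  -- λ = (1^{a₁}, 2^{a₂}),  n = a₁ + a₂,  s₀ = 0, s₁ = a₁, s₂ = n.
  n : ℕ
  n = a₁ + a₂

  t₀ t₁ t₂ : Vertex
  t₀ = (0 , n)
  t₁ = (a₁ , a₂)
  t₂ = (n , 0)

  Terminal : Vertex → Set
  Terminal t = t ≡ t₀ ⊎ t ≡ t₁ ⊎ t ≡ t₂

  Γ : Subgraph
  Γ e = Σ Vertex λ t → Terminal t × OnPath Q e t

  IsLadder : Subgraph → Set
  IsLadder L = (L ⊆ Γ)
             × (∀ t → Terminal t → NEPath L origin t)
             × (∀ e → L e → Σ Vertex λ t → Terminal t × OnPath L e t)

  M : Subgraph
  M (ver x y) = x ≡ 0 × y < n
  M (hor x y) = y ≡ 0 × x < n

  P : Subgraph → Subgraph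
  P L e = OnPath L e t₁

  -- r(x,y) = (a₁ - x, a₂ - y) acting on edges (an edge is sent to the edge
  -- joining the images of its endpoints).
  r : Edge → Edge
  r (hor x y) = hor (a₁ ∸ suc x) (a₂ ∸ y)
  r (ver x y) = ver (a₁ ∸ x) (a₂ ∸ suc y)

  rImage : Subgraph → Subgraph
  rImage S e = Σ Edge λ e' → S e' × r e' ≡ e

  τ : Subgraph → Subgraph
  τ L e = M e ⊎ rImage (P L) e

-- Every edge of a ladder lies on a path to t₀ or t₂, hence in M, or on a path
-- to t₁, hence in P(L); so L = M ∪ P(L).  The rotation r reverses NE paths inside
-- the rectangle [0,a₁]×[0,a₂], so r(P(L)) is again a union of NE paths from the
-- origin to t₁, which makes τ(L) a ladder.  Conversely P(τ L) = r(P(L)): an edge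
-- of M on a path to t₁ is followed, on that path, by an edge leaving the axis, and
-- that edge lies in r(P(L)), whose path from the origin then runs along the axis
-- over the given edge.  Since r is an involution, τ(τ L) = M ∪ P(L) = L, and τ is
-- monotone, so it is an order automorphism of order 2.

module Submission where

open import Defs
open import Data.Nat using (ℕ; zero; suc; _+_; _∸_; _≤_; _<_; z≤n)
open import Data.Nat.Properties
open import Data.Product using (Σ; _×_; _,_; proj₁; proj₂)
open import Data.Empty using (⊥)
open import Data.Sum using (inj₁; inj₂; [_,_])
open import Function.Base using (_∘_)
open import Function.Bundles using (_⇔_; mk⇔)
open import Relation.Nullary using (¬_; yes; no; contradiction)
open import Relation.Unary using (_⊆_; _≐_; _∪_)
open import Relation.Binary.PropositionalEquality using (_≡_; refl; sym; trans; cong; cong₂; subst)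

infix 4 _≼_

_≼_ : Vertex → Vertex → Set
u ≼ w = proj₁ u ≤ proj₁ w × proj₂ u ≤ proj₂ w

module _ {L : Subgraph} where

  infixr 5 _++ₚ_

  _++ₚ_ : ∀ {u v w} → NEPath L u v → NEPath L v w → NEPath L u w
  stop ++ₚ q = q
  east l p ++ₚ q = east l (p ++ₚ q)
  north l p ++ₚ q = north l (p ++ₚ q)

  NEPath-≼ : ∀ {u w} → NEPath L u w → u ≼ w
  NEPath-≼ stop = ≤-refl , ≤-refl
  NEPath-≼ (east _ p) = let x≤ , y≤ = NEPath-≼ p in <⇒≤ x≤ , y≤
  NEPath-≼ (north _ p) = let x≤ , y≤ = NEPath-≼ p in x≤ , <⇒≤ y≤

  edgePath : ∀ e → L e → NEPath L (src e) (tgt e)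
  edgePath (hor _ _) l = east l stop
  edgePath (ver _ _) l = north l stop

  columnPath : ∀ {x y y′} → y ≤ y′ → (∀ {k} → y ≤ k → k < y′ → L (ver x k)) →
               NEPath L (x , y) (x , y′)
  columnPath {x} {y} {y′} y≤y′ inL =
    subst (λ z → NEPath L (x , y) (x , z)) (m∸n+n≡m y≤y′) (go _ λ y≤k → inL y≤k ∘ bound)
    where
    bound : ∀ {k} → k < y′ ∸ y + y → k < y′
    bound = subst (_ <_) (m∸n+n≡m y≤y′)
    go : ∀ d → (∀ {k} → y ≤ k → k < d + y → L (ver x k)) → NEPath L (x , y) (x , d + y)
    go zero _ = stop
    go (suc d) inL′ = go d (λ y≤k → inL′ y≤k ∘ m<n⇒m<1+n) ++ₚ north (inL′ (m≤n+m y d) ≤-refl) stop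

  rowPath : ∀ {x x′ y} → x ≤ x′ → (∀ {k} → x ≤ k → k < x′ → L (hor k y)) →
            NEPath L (x , y) (x′ , y)
  rowPath {x} {x′} {y} x≤x′ inL =
    subst (λ z → NEPath L (x , y) (z , y)) (m∸n+n≡m x≤x′) (go _ λ x≤k → inL x≤k ∘ bound)
    where
    bound : ∀ {k} → k < x′ ∸ x + x → k < x′
    bound = subst (_ <_) (m∸n+n≡m x≤x′)
    go : ∀ d → (∀ {k} → x ≤ k → k < d + x → L (hor k y)) → NEPath L (x , y) (d + x , y)
    go zero _ = stop
    go (suc d) inL′ = go d (λ x≤k → inL′ x≤k ∘ m<n⇒m<1+n) ++ₚ east (inL′ (m≤n+m x d) ≤-refl) stop

  column-edge : ∀ {x y₀ y₁ y} → NEPath L (x , y₀) (x , y₁) → y₀ ≤ y → y < y₁ → L (ver x y)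
  column-edge stop y₀≤y y<y₀ = contradiction (≤-<-trans y₀≤y y<y₀) (n≮n _)
  column-edge (east _ p) _ _ = contradiction (proj₁ (NEPath-≼ p)) (n≮n _)
  column-edge {y = y} (north {y = y₀} l p) y₀≤y y<y₁ with y₀ ≟ y
  ... | yes refl = l
  ... | no y₀≢y = column-edge p (≤∧≢⇒< y₀≤y y₀≢y) y<y₁

  row-edge : ∀ {y x₀ x₁ x} → NEPath L (x₀ , y) (x₁ , y) → x₀ ≤ x → x < x₁ → L (hor x y)
  row-edge stop x₀≤x x<x₀ = contradiction (≤-<-trans x₀≤x x<x₀) (n≮n _)
  row-edge (north _ p) _ _ = contradiction (proj₂ (NEPath-≼ p)) (n≮n _)
  row-edge {x = x} (east {x = x₀} l p) x₀≤x x<x₁ with x₀ ≟ x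
  ... | yes refl = l
  ... | no x₀≢x = row-edge p (≤∧≢⇒< x₀≤x x₀≢x) x<x₁

  leaveColumn : ∀ {x y w} → NEPath L (x , y) w → x < proj₁ w → Σ ℕ λ k → y ≤ k × L (hor x k)
  leaveColumn stop x<x = contradiction x<x (n≮n _)
  leaveColumn (east l _) _ = _ , ≤-refl , l
  leaveColumn (north _ p) x<w = let k , y<k , l = leaveColumn p x<w in k , <⇒≤ y<k , l

  leaveRow : ∀ {x y w} → NEPath L (x , y) w → y < proj₂ w → Σ ℕ λ k → x ≤ k × L (ver k y)
  leaveRow stop y<y = contradiction y<y (n≮n _)
  leaveRow (north l _) _ = _ , ≤-refl , l
  leaveRow (east _ p) y<w = let k , x<k , l = leaveRow p y<w in k , <⇒≤ x<k , l

  NEPath-onPath : ∀ {t u v} → NEPath L origin u → NEPath L u v → NEPath L v t →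
                  NEPath (λ e → OnPath L e t) u v
  NEPath-onPath pre stop post = stop
  NEPath-onPath pre (east l p) post = east (l , pre , p ++ₚ post) (NEPath-onPath (pre ++ₚ east l stop) p post)
  NEPath-onPath pre (north l p) post = north (l , pre , p ++ₚ post) (NEPath-onPath (pre ++ₚ north l stop) p post)

NEPath-map : ∀ {L L′ : Subgraph} → L ⊆ L′ → ∀ {u w} → NEPath L u w → NEPath L′ u w
NEPath-map L⊆L′ stop = stop
NEPath-map L⊆L′ (east l p) = east (L⊆L′ l) (NEPath-map L⊆L′ p)
NEPath-map L⊆L′ (north l p) = north (L⊆L′ l) (NEPath-map L⊆L′ p)

suc[m∸1+n]≡m∸n : ∀ {m n} → suc n ≤ m → suc (m ∸ suc n) ≡ m ∸ n
suc[m∸1+n]≡m∸n h = sym (+-∸-assoc 1 h)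

module TwoPart (a₁ a₂ : ℕ) where
  open Shape a₁ a₂

  OnTerminalPath : Subgraph → Edge → Set
  OnTerminalPath L e = Σ Vertex λ t → Terminal t × OnPath L e t

  rv : Vertex → Vertex
  rv (x , y) = (a₁ ∸ x , a₂ ∸ y)

  rv-t₁ : rv t₁ ≡ origin
  rv-t₁ = cong₂ _,_ (n∸n≡0 a₁) (n∸n≡0 a₂)

  rv-tgt : ∀ e → rv (tgt e) ≡ src (r e)
  rv-tgt (hor _ _) = refl
  rv-tgt (ver _ _) = refl

  rv-src : ∀ e → tgt e ≼ t₁ → rv (src e) ≡ tgt (r e)
  rv-src (hor x y) (sx≤a₁ , _) = cong (_, a₂ ∸ y) (sym (suc[m∸1+n]≡m∸n sx≤a₁))
  rv-src (ver x y) (_ , sy≤a₂) = cong (a₁ ∸ x ,_) (sym (suc[m∸1+n]≡m∸n sy≤a₂))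

  r-involutive : ∀ e → tgt e ≼ t₁ → r (r e) ≡ e
  r-involutive (hor x y) (sx≤a₁ , y≤a₂) = cong₂ hor
    (trans (cong (a₁ ∸_) (suc[m∸1+n]≡m∸n sx≤a₁)) (m∸[m∸n]≡n (<⇒≤ sx≤a₁))) (m∸[m∸n]≡n y≤a₂)
  r-involutive (ver x y) (x≤a₁ , sy≤a₂) = cong₂ ver
    (m∸[m∸n]≡n x≤a₁) (trans (cong (a₂ ∸_) (suc[m∸1+n]≡m∸n sy≤a₂)) (m∸[m∸n]≡n (<⇒≤ sy≤a₂)))

  rImage-mono : ∀ {S S′} → S ⊆ S′ → rImage S ⊆ rImage S′
  rImage-mono S⊆S′ (e , s , re≡) = e , S⊆S′ s , re≡

  reverse : ∀ {S u w} → NEPath S u w → w ≼ t₁ → NEPath (rImage S) (rv w) (rv u)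
  reverse stop _ = stop
  reverse {S} (east {x} {y} l p) w≼t₁ = reverse p w≼t₁ ++ₚ
    subst (λ z → NEPath (rImage S) (a₁ ∸ suc x , a₂ ∸ y) (z , a₂ ∸ y))
      (suc[m∸1+n]≡m∸n (≤-trans (proj₁ (NEPath-≼ p)) (proj₁ w≼t₁))) (east (_ , l , refl) stop)
  reverse {S} (north {x} {y} l p) w≼t₁ = reverse p w≼t₁ ++ₚ
    subst (λ z → NEPath (rImage S) (a₁ ∸ x , a₂ ∸ suc y) (a₁ ∸ x , z))
      (suc[m∸1+n]≡m∸n (≤-trans (proj₂ (NEPath-≼ p)) (proj₂ w≼t₁))) (north (_ , l , refl) stop)

  reverse-to-t₁ : ∀ {S u} → NEPath S u t₁ → NEPath (rImage S) origin (rv u)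
  reverse-to-t₁ {S} {u} p = subst (λ z → NEPath (rImage S) z (rv u)) rv-t₁ (reverse p (≤-refl , ≤-refl))

  P-mono : ∀ {L L′} → L ⊆ L′ → P L ⊆ P L′
  P-mono L⊆L′ (l , pre , post) = L⊆L′ l , NEPath-map L⊆L′ pre , NEPath-map L⊆L′ post

  P-≼ : ∀ {L} e → P L e → tgt e ≼ t₁
  P-≼ e (_ , _ , post) = NEPath-≼ post

  rImage-P⊆P-rImage-P : ∀ {L} → rImage (P L) ⊆ P (rImage (P L))
  rImage-P⊆P-rImage-P {L} (e , pe@(l , pre , post) , refl) =
      (e , pe , refl)
    , subst (NEPath (rImage (P L)) origin) (rv-tgt e)
        (reverse-to-t₁ (NEPath-onPath (pre ++ₚ edgePath e l) post stop))
    , subst (λ z → NEPath (rImage (P L)) z t₁) (rv-src e (P-≼ e pe))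
        (reverse (NEPath-onPath stop pre (edgePath e l ++ₚ post)) (NEPath-≼ (edgePath e l ++ₚ post)))

  rImage-rImage-P : ∀ {L} → rImage (rImage (P L)) ≐ P L
  rImage-rImage-P {L} =
      (λ { (_ , (e , pe , refl) , refl) → subst (P L) (sym (r-involutive e (P-≼ e pe))) pe })
    , (λ {e} pe → r e , (e , pe , refl) , r-involutive e (P-≼ e pe))

  M-column : ∀ {L y y′} → M ⊆ L → y ≤ y′ → y′ ≤ n → NEPath L (0 , y) (0 , y′)
  M-column M⊆L y≤y′ y′≤n = columnPath y≤y′ λ _ k<y′ → M⊆L (refl , <-≤-trans k<y′ y′≤n)

  M-row : ∀ {L x x′} → M ⊆ L → x ≤ x′ → x′ ≤ n → NEPath L (x , 0) (x′ , 0)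
  M-row M⊆L x≤x′ x′≤n = rowPath x≤x′ λ _ k<x′ → M⊆L (refl , <-≤-trans k<x′ x′≤n)

  M-onTerminalPath : ∀ {L} → M ⊆ L → ∀ e → M e → OnTerminalPath L e
  M-onTerminalPath M⊆L (ver x y) m@(refl , y<n) =
    t₀ , inj₁ refl , M⊆L m , M-column M⊆L z≤n (<⇒≤ y<n) , M-column M⊆L y<n ≤-refl
  M-onTerminalPath M⊆L (hor x y) m@(refl , x<n) =
    t₂ , inj₂ (inj₂ refl) , M⊆L m , M-row M⊆L z≤n (<⇒≤ x<n) , M-row M⊆L x<n ≤-refl

  M-below-t₀ : ∀ e → tgt e ≼ t₀ → M e
  M-below-t₀ (ver x y) (x≤0 , sy≤n) = n≤0⇒n≡0 x≤0 , sy≤n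
  M-below-t₀ (hor x y) (() , _)

  M-below-t₂ : ∀ e → tgt e ≼ t₂ → M e
  M-below-t₂ (hor x y) (sx≤n , y≤0) = n≤0⇒n≡0 y≤0 , sx≤n
  M-below-t₂ (ver x y) (_ , ())

  M⊆ladder : ∀ L → IsLadder L → M ⊆ L
  M⊆ladder L (_ , path , _) {ver x y} (refl , y<n) = column-edge (path t₀ (inj₁ refl)) z≤n y<n
  M⊆ladder L (_ , path , _) {hor x y} (refl , x<n) = row-edge (path t₂ (inj₂ (inj₂ refl))) z≤n x<n

  ladder⊆M∪P : ∀ {L} → IsLadder L → L ⊆ M ∪ P L
  ladder⊆M∪P (_ , _ , onPath) {e} l with onPath e l
  ... | _ , inj₁ refl , _ , _ , post = inj₁ (M-below-t₀ e (NEPath-≼ post))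
  ... | _ , inj₂ (inj₁ refl) , onP = inj₂ onP
  ... | _ , inj₂ (inj₂ refl) , _ , _ , post = inj₁ (M-below-t₂ e (NEPath-≼ post))

  ⊆Γ : ∀ {L} → (∀ e → L e → OnTerminalPath L e) → L ⊆ Γ
  ⊆Γ onPath {e} l =
    let t , terminal , _ , pre , post = onPath e l
    in t , terminal , _ , NEPath-map _ pre , NEPath-map _ post

  isLadder-M∪P : ∀ {L} → M ⊆ L → NEPath L origin t₁ → L ⊆ M ∪ P L → IsLadder L
  isLadder-M∪P {L} M⊆L toT₁ L⊆M∪P = ⊆Γ onTerminalPath , path , onTerminalPath
    where
    onTerminalPath : ∀ e → L e → OnTerminalPath L e
    onTerminalPath e l = [ M-onTerminalPath M⊆L e , (λ onP → t₁ , inj₂ (inj₁ refl) , onP) ] (L⊆M∪P l)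
    path : ∀ t → Terminal t → NEPath L origin t
    path _ (inj₁ refl) = M-column M⊆L z≤n ≤-refl
    path _ (inj₂ (inj₁ refl)) = toT₁
    path _ (inj₂ (inj₂ refl)) = M-row M⊆L z≤n ≤-refl

  τ-mono : ∀ {L L′} → L ⊆ L′ → τ L ⊆ τ L′
  τ-mono L⊆L′ = [ inj₁ , inj₂ ∘ rImage-mono (P-mono L⊆L′) ]

  rImage-P⊆P-τ : ∀ {L} → rImage (P L) ⊆ P (τ L)
  rImage-P⊆P-τ = P-mono inj₂ ∘ rImage-P⊆P-rImage-P

  τ-isLadder : ∀ L → IsLadder L → IsLadder (τ L)
  τ-isLadder L (_ , path , _) = isLadder-M∪P inj₁
    (NEPath-map inj₂ (reverse-to-t₁ (NEPath-onPath stop (path t₁ (inj₂ (inj₁ refl))) stop)))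
    [ inj₁ , inj₂ ∘ rImage-P⊆P-τ ]

  P-τ⊆rImage-P : 1 ≤ a₁ → 1 ≤ a₂ → ∀ {L} → P (τ L) ⊆ rImage (P L)
  P-τ⊆rImage-P _ _ (inj₂ re , _) = re
  P-τ⊆rImage-P 1≤a₁ _ {L} {ver x y} (inj₁ (refl , _) , _ , post) with leaveColumn post 1≤a₁
  ... | _ , sy≤k , inj₁ (refl , _) = contradiction sy≤k λ ()
  ... | _ , sy≤k , inj₂ exit = column-edge (proj₁ (proj₂ (rImage-P⊆P-rImage-P exit))) z≤n sy≤k
  P-τ⊆rImage-P _ 1≤a₂ {L} {hor x y} (inj₁ (refl , _) , _ , post) with leaveRow post 1≤a₂
  ... | _ , sx≤k , inj₁ (refl , _) = contradiction sx≤k λ ()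
  ... | _ , sx≤k , inj₂ exit = row-edge (proj₁ (proj₂ (rImage-P⊆P-rImage-P exit))) z≤n sx≤k

  τ-involutive : 1 ≤ a₁ → 1 ≤ a₂ → ∀ L → IsLadder L → τ (τ L) ≐ L
  τ-involutive 1≤a₁ 1≤a₂ L lad =
      [ M⊆ladder L lad , proj₁ ∘ proj₁ rImage-rImage-P ∘ rImage-mono (P-τ⊆rImage-P 1≤a₁ 1≤a₂) ]
    , [ inj₁ , inj₂ ∘ rImage-mono rImage-P⊆P-τ ∘ proj₂ rImage-rImage-P ] ∘ ladder⊆M∪P lad

  topRow : Subgraph
  topRow (hor x y) = y ≡ a₂ × x < a₁
  topRow (ver _ _) = ⊥

  topLadder : Subgraph
  topLadder = M ∪ topRow

  a₂≤n : a₂ ≤ n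
  a₂≤n = m≤n+m a₂ a₁

  toCorner : NEPath topLadder origin (0 , a₂)
  toCorner = M-column inj₁ z≤n a₂≤n

  topPath : ∀ {x x′} → x ≤ x′ → x′ ≤ a₁ → NEPath topLadder (x , a₂) (x′ , a₂)
  topPath x≤x′ x′≤a₁ = rowPath x≤x′ λ _ k<x′ → inj₂ (refl , <-≤-trans k<x′ x′≤a₁)

  topLadder-isLadder : IsLadder topLadder
  topLadder-isLadder = isLadder-M∪P inj₁ (toCorner ++ₚ topPath z≤n ≤-refl) [ inj₁ , onTop ]
    where
    onTop : topRow ⊆ M ∪ P topLadder
    onTop {hor x _} top@(refl , x<a₁) =
      inj₂ (inj₂ top , toCorner ++ₚ topPath z≤n (<⇒≤ x<a₁) , topPath x<a₁ ≤-refl)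

  column-P-topLadder : ∀ {y} → y < a₂ → P topLadder (ver 0 y)
  column-P-topLadder y<a₂ =
      inj₁ (refl , <-≤-trans y<a₂ a₂≤n)
    , M-column inj₁ z≤n (≤-trans (<⇒≤ y<a₂) a₂≤n)
    , M-column inj₁ y<a₂ a₂≤n ++ₚ topPath z≤n ≤-refl

  τ-topLadder≉topLadder : 1 ≤ a₁ → 1 ≤ a₂ → ¬ (τ topLadder ≐ topLadder)
  τ-topLadder≉topLadder 1≤a₁ 1≤a₂ (τ⊆ , _) with τ⊆ corner
    where
    1+[a₂∸1]≡a₂ : suc (a₂ ∸ 1) ≡ a₂
    1+[a₂∸1]≡a₂ = m+[n∸m]≡n 1≤a₂
    corner : τ topLadder (ver a₁ 0)
    corner = inj₂ (ver 0 (a₂ ∸ 1) , column-P-topLadder (≤-reflexive 1+[a₂∸1]≡a₂)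
                  , cong (ver a₁) (trans (cong (a₂ ∸_) 1+[a₂∸1]≡a₂) (n∸n≡0 a₂)))
  ... | inj₁ (a₁≡0 , _) = contradiction (subst (1 ≤_) a₁≡0 1≤a₁) λ ()

proposition4p5 : (a₁ a₂ : ℕ) → 1 ≤ a₁ → 1 ≤ a₂ →
    let open Shape a₁ a₂ in
      (∀ L → IsLadder L → M ⊆ L)
    × (∀ L → IsLadder L → IsLadder (τ L))
    × (∀ L L′ → IsLadder L → IsLadder L′ → (L ⊆ L′ ⇔ τ L ⊆ τ L′))
    × (∀ L → IsLadder L → τ (τ L) ≐ L)
    × Σ Subgraph (λ L → IsLadder L × ¬ (τ L ≐ L))
proposition4p5 a₁ a₂ 1≤a₁ 1≤a₂ =
    M⊆ladder
  , τ-isLadder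
  , (λ L L′ lad lad′ → mk⇔ τ-mono λ τL⊆τL′ →
       proj₁ (τ-involutive 1≤a₁ 1≤a₂ L′ lad′) ∘ τ-mono τL⊆τL′ ∘ proj₂ (τ-involutive 1≤a₁ 1≤a₂ L lad))
  , τ-involutive 1≤a₁ 1≤a₂
  , topLadder , topLadder-isLadder , τ-topLadder≉topLadder 1≤a₁ 1≤a₂
  where open TwoPart a₁ a₂
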